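{- Let $\lambda\in(\mathcal{Q}_A)_0$ with $\lambda_a\in\{0,1\}$ for all $a\in A$. If the Hasse diagram of the reduced poset $\overline{(\mathcal{P},A,\lambda)}$ is not connected, then $\lambda$ is not $\mathcal{C}$-indecomposable.
   Context: Let $(\mathcal{P},\prec)$ be a finite poset and $A\subseteq\mathcal{P}$ a subset containing all maximal and all minimal elements of $\mathcal{P}$. Let $\mathcal{Q}_A:=\{\lambda\in\mathbb{Z}_{\ge 0}^A : \lambda_a\le\lambda_b \text{ whenever } a\prec b\}$ and $(\mathcal{Q}_A)_0:=\{\lambda\in\mathcal{Q}_A : \lambda_a=0 \text{ for some } a\in A\}$. For $\lambda\in\mathcal{Q}_A$ the marked chain polytope is $\mathcal{C}(\mathcal{P},A)_\lambda=\{s\in\mathbb{R}_{\ge0}^{\mathcal{P}\setminus A} : s_{x_1}+\dots+s_{x_n}\le\lambda_b-\lambda_a \text{ for all chains } a\prec x_1\prec\dots\prec x_n\prec b \text{ with } a,b\in A,\ x_i\in\mathcal{P}\setminus A\}$, and $S_{\mathcal{C}}(\lambda):=\mathcal{C}(\mathcal{P},A)_\lambda\cap\mathbb{Z}^{\mathcal{P}\setminus A}$. An element $\lambda\in(\mathcal{Q}_A)_0$ is $\mathcal{C}$-indecomposable if for all $\mu,\tau\in\mathcal{Q}_A$, the equality of Minkowski sums $S_{\mathcal{C}}(\lambda)=S_{\mathcal{C}}(\mu)+S_{\mathcal{C}}(\tau)$ implies $\mu=0$ or $\tau=0$. The reduced poset $\overline{(\mathcal{P},A,\lambda)}$ is the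 full (induced) subposet of $\mathcal{P}$ on $\{x\in\mathcal{P} : \text{there is no } a\in A \text{ with } \lambda_a=0 \text{ and } x\preceq a\}$. -}

module Defs where

open import Level using (0ℓ)
open import Data.Nat using (ℕ; _+_; _≤_)
open import Data.Fin using (Fin)
open import Data.Fin.Subset using (Subset; _∈_; _∉_)
open import Data.List using (List; []; _∷_; map)
open import Data.Nat.ListAction using (sum)
open import Data.List.Relation.Unary.All using (All)
open import Data.Product using (Σ; ∃; ∃₂; _×_; _,_)
open import Data.Sum using (_⊎_)
open import Relation.Binary using (Rel)
open import Relation.Binary.Construct.Closure.ReflexiveTransitive using (Star)
open import Relation.Nullary using (¬_)
open import Relation.Binary.PropositionalEquality using (_≡_)

-- A marking λ ∈ ℤ≥0^A is encoded as a
-- function Fin n → ℕ whose values outside A are irrelevant (every notion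
-- below only inspects it on A).  A point of ℤ^(P∖A) is encoded as a
-- function Fin n → ℕ that vanishes on A (points of S_C are nonnegative).
module _ {n : ℕ} (_≺_ : Rel (Fin n) 0ℓ) (A : Subset n) where

  _⪯_ : Fin n → Fin n → Set
  x ⪯ y = x ≡ y ⊎ x ≺ y

  InQ : (Fin n → ℕ) → Set
  InQ lam = ∀ a b → a ∈ A → b ∈ A → a ≺ b → lam a ≤ lam b

  InQ0 : (Fin n → ℕ) → Set
  InQ0 lam = InQ lam × ∃ λ a → a ∈ A × lam a ≡ 0

  IsZero : (Fin n → ℕ) → Set
  IsZero lam = ∀ a → a ∈ A → lam a ≡ 0

  Chain : Fin n → List (Fin n) → Fin n → Set
  Chain a [] b = a ≺ b
  Chain a (x ∷ xs) b = a ≺ x × Chain x xs b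

  InS : (Fin n → ℕ) → (Fin n → ℕ) → Set
  InS lam s =
    (∀ a → a ∈ A → s a ≡ 0) ×
    (∀ a b (xs : List (Fin n)) → a ∈ A → b ∈ A → All (_∉ A) xs →
       Chain a xs b → sum (map s xs) + lam a ≤ lam b)

  InMinkowskiSum : (Fin n → ℕ) → (Fin n → ℕ) → (Fin n → ℕ) → Set
  InMinkowskiSum mu tau s =
    ∃₂ λ u v → InS mu u × InS tau v × (∀ x → s x ≡ u x + v x)

  SumEq : (Fin n → ℕ) → (Fin n → ℕ) → (Fin n → ℕ) → Set
  SumEq lam mu tau =
    ∀ s → (InS lam s → InMinkowskiSum mu tau s) × (InMinkowskiSum mu tau s → InS lam s)

  CIndecomposable : (Fin n → ℕ) → Set
  CIndecomposable lam =
    InQ0 lam ×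
    (∀ mu tau → InQ mu → InQ tau → SumEq lam mu tau → IsZero mu ⊎ IsZero tau)

  InReduced : (Fin n → ℕ) → Fin n → Set
  InReduced lam x = ¬ (∃ λ a → a ∈ A × lam a ≡ 0 × x ⪯ a)

  Reduced : (Fin n → ℕ) → Set
  Reduced lam = Σ (Fin n) (InReduced lam)

  Covers : (lam : Fin n → ℕ) → Reduced lam → Reduced lam → Set
  Covers lam (x , _) (y , _) =
    x ≺ y × ¬ (∃ λ z → InReduced lam z × x ≺ z × z ≺ y)

  HasseEdge : (lam : Fin n → ℕ) → Reduced lam → Reduced lam → Set
  HasseEdge lam u v = Covers lam u v ⊎ Covers lam v u

  HasseConnected : (Fin n → ℕ) → Set
  HasseConnected lam = ∀ u v → Star (HasseEdge lam) u v

-- Points of S_C(λ) vanish off the reduced poset R: an element lying below a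
-- zero-marked element of A sits on a chain from A to that element, whose
-- total weight is bounded by 0.  R is an up-set whose maximal elements lie in
-- A with nonzero marks, and a Hasse component C of R is closed upwards in P
-- and downwards within R.  Cutting λ along C (μ = λ on C, τ = λ off C) then
-- splits every point s as s|C + s|∁C ∈ S_C(μ) + S_C(τ), and μ, τ ≠ 0 as soon
-- as R has two components.  If instead R is a single point, that point lies
-- in A, so S_C(λ) = {0} = S_C(λ) + S_C(λ).
module Submission where

open import Defs
open import Level using (0ℓ)
open import Data.Empty using (⊥-elim)
open import Data.Nat using (ℕ; zero; suc; _+_; _≤_; z≤n; _≟_)
open import Data.Nat.Properties
  using (≤-refl; ≤-reflexive; ≤-trans; +-mono-≤; +-monoˡ-≤; m≤m+n; m≤n+m; n≤0⇒n≡0;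
         +-identityʳ; +-commutativeSemigroup; module ≤-Reasoning)
open import Algebra.Properties.CommutativeSemigroup +-commutativeSemigroup using (interchange)
open import Data.Fin using (Fin; zero; suc)
open import Data.Fin.Subset using (Subset; _∈_; _∉_)
open import Data.Fin.Subset.Properties using (_∈?_)
open import Data.Fin.Properties using (any?)
open import Data.Fin.Induction using (spo-wellFounded; spo-noetherian)
open import Data.List using (List; []; _∷_; map)
open import Data.Nat.ListAction using (sum)
open import Data.List.Relation.Unary.All using (All; []; _∷_; universal)
import Data.List.Relation.Unary.All as All
open import Data.Product using (Σ; ∃; ∃₂; _×_; _,_; proj₁)
open import Data.Sum using (_⊎_; inj₁; inj₂; [_,_]) renaming (swap to ⊎-swap)
open import Function using (_∘_; flip)
open import Induction.WellFounded using (Acc; acc)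
open import Relation.Binary using (Rel; IsStrictPartialOrder; Decidable)
open import Relation.Binary.Construct.Closure.ReflexiveTransitive using (Star; ε; _◅_; _◅◅_; reverse)
open import Relation.Binary.PropositionalEquality using (_≡_; refl; sym; trans; cong₂; subst)
open import Relation.Nullary using (¬_; yes; no)
open import Relation.Nullary.Decidable using (_×-dec_; decidable-stable; ¬¬-excluded-middle)
import Relation.Unary as U
open import Relation.Unary.Properties using (∁?)

¬¬-∀-Fin : ∀ {n} {P : Fin n → Set} → (∀ i → ¬ ¬ P i) → ¬ ¬ (∀ i → P i)
¬¬-∀-Fin {zero}  _   k = k λ ()
¬¬-∀-Fin {suc n} ¬¬P k =
  ¬¬P zero λ P0 → ¬¬-∀-Fin (¬¬P ∘ suc) λ Ps → k λ { zero → P0 ; (suc i) → Ps i }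

¬¬-decidable : ∀ {n} (P : Fin n → Set) → ¬ ¬ U.Decidable P
¬¬-decidable P = ¬¬-∀-Fin λ _ → ¬¬-excluded-middle

¬¬-decidable₂ : ∀ {n} (R : Rel (Fin n) 0ℓ) → ¬ ¬ Decidable R
¬¬-decidable₂ R = ¬¬-∀-Fin λ x → ¬¬-decidable (R x)

module _ {X : Set} where

  sum-map-mono : ∀ {f g : X → ℕ} → (∀ x → f x ≤ g x) → ∀ xs → sum (map f xs) ≤ sum (map g xs)
  sum-map-mono f≤g []       = z≤n
  sum-map-mono f≤g (x ∷ xs) = +-mono-≤ (f≤g x) (sum-map-mono f≤g xs)

  sum-map-zero : ∀ {f : X → ℕ} {xs} → All (λ x → f x ≡ 0) xs → sum (map f xs) ≡ 0
  sum-map-zero []         = refl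
  sum-map-zero (fx≡0 ∷ p) = cong₂ _+_ fx≡0 (sum-map-zero p)

  sum-map-+ : ∀ {f g h : X → ℕ} → (∀ x → h x ≡ f x + g x) →
              ∀ xs → sum (map h xs) ≡ sum (map f xs) + sum (map g xs)
  sum-map-+ h≡f+g []       = refl
  sum-map-+ {f} {g} h≡f+g (x ∷ xs) =
    trans (cong₂ _+_ (h≡f+g x) (sum-map-+ h≡f+g xs)) (interchange (f x) (g x) _ _)

  _↾_ : {P : U.Pred X 0ℓ} → (X → ℕ) → U.Decidable P → X → ℕ
  (f ↾ P?) x with P? x
  ... | yes _ = f x
  ... | no _  = 0

  module _ {P : U.Pred X 0ℓ} (P? : U.Decidable P) {f : X → ℕ} {x : X} where

    ↾-in : P x → (f ↾ P?) x ≡ f x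
    ↾-in Px with P? x
    ... | yes _  = refl
    ... | no ¬Px = ⊥-elim (¬Px Px)

    ↾-out : ¬ P x → (f ↾ P?) x ≡ 0
    ↾-out ¬Px with P? x
    ... | yes Px = ⊥-elim (¬Px Px)
    ... | no _   = refl

    ↾-≤ : (f ↾ P?) x ≤ f x
    ↾-≤ with P? x
    ... | yes _ = ≤-refl
    ... | no _  = z≤n

    ↾-zero : f x ≡ 0 → (f ↾ P?) x ≡ 0
    ↾-zero fx≡0 = n≤0⇒n≡0 (subst ((f ↾ P?) x ≤_) fx≡0 ↾-≤)

    ↾-split : f x ≡ (f ↾ P?) x + (f ↾ ∁? P?) x
    ↾-split with P? x
    ... | yes _ = sym (+-identityʳ (f x))
    ... | no _  = refl

module Order {n : ℕ} {_≺_ : Rel (Fin n) 0ℓ}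
             (spo : IsStrictPartialOrder _≡_ _≺_) (_≺?_ : Decidable _≺_) where

  open IsStrictPartialOrder spo using () renaming (trans to ≺-trans)

  _⋖_ : Rel (Fin n) 0ℓ
  x ⋖ y = x ≺ y × ¬ (∃ λ z → x ≺ z × z ≺ y)

  ∃-maximal-above : ∀ x → ∃ λ a → (x ≡ a ⊎ x ≺ a) × (∀ y → ¬ (a ≺ y))
  ∃-maximal-above x = go x (spo-noetherian spo x)
    where
      go : ∀ x → Acc (flip _≺_) x → ∃ λ a → (x ≡ a ⊎ x ≺ a) × (∀ y → ¬ (a ≺ y))
      go x (acc rec) with any? (x ≺?_)
      ... | no ∄y = x , inj₁ refl , λ y x≺y → ∄y (y , x≺y)
      ... | yes (y , x≺y) with go y (rec x≺y)
      ...   | a , inj₁ refl , a-max = a , inj₂ x≺y , a-max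
      ...   | a , inj₂ y≺a  , a-max = a , inj₂ (≺-trans x≺y y≺a) , a-max

  ∃-cover-below : ∀ {x y} → x ≺ y → ∃ λ z → x ⋖ z × (z ≡ y ⊎ z ≺ y)
  ∃-cover-below {x} {y} = go y (spo-wellFounded spo y)
    where
      go : ∀ y → Acc _≺_ y → x ≺ y → ∃ λ z → x ⋖ z × (z ≡ y ⊎ z ≺ y)
      go y (acc rec) x≺y with any? (λ w → x ≺? w ×-dec w ≺? y)
      ... | no ∄w = y , (x≺y , ∄w) , inj₁ refl
      ... | yes (w , x≺w , w≺y) with go w (rec w≺y) x≺w
      ...   | z , x⋖z , inj₁ refl = z , x⋖z , inj₂ w≺y
      ...   | z , x⋖z , inj₂ z≺w  = z , x⋖z , inj₂ (≺-trans z≺w w≺y)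

module Chains {n : ℕ} {_≺_ : Rel (Fin n) 0ℓ} (spo : IsStrictPartialOrder _≡_ _≺_) (A : Subset n) where

  open IsStrictPartialOrder spo using () renaming (trans to ≺-trans)

  chain-lt : ∀ {a b} xs → Chain _≺_ A a xs b → a ≺ b
  chain-lt []       a≺b        = a≺b
  chain-lt (x ∷ xs) (a≺x , ch) = ≺-trans a≺x (chain-lt xs ch)

  chain-below : ∀ {a b} xs → Chain _≺_ A a xs b → All (_≺ b) xs
  chain-below []       _        = []
  chain-below (x ∷ xs) (_ , ch) = chain-lt xs ch ∷ chain-below xs ch

module Minkowski {n : ℕ} (_≺_ : Rel (Fin n) 0ℓ) (A : Subset n) where

  InS-+ : ∀ {lam mu tau s u v} → (∀ a → lam a ≡ mu a + tau a) →
          InS _≺_ A mu u → InS _≺_ A tau v → (∀ x → s x ≡ u x + v x) → InS _≺_ A lam s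
  InS-+ {lam} {mu} {tau} {s} {u} {v} lam≡ (u-A , u-chain) (v-A , v-chain) s≡ = s-A , s-chain
    where
      s-A : ∀ a → a ∈ A → s a ≡ 0
      s-A a aA = trans (s≡ a) (cong₂ _+_ (u-A a aA) (v-A a aA))

      s-chain : ∀ a b xs → a ∈ A → b ∈ A → All (_∉ A) xs → Chain _≺_ A a xs b →
                sum (map s xs) + lam a ≤ lam b
      s-chain a b xs aA bA xs∉A ch = begin
        sum (map s xs) + lam a                                ≡⟨ cong₂ _+_ (sum-map-+ s≡ xs) (lam≡ a) ⟩
        (sum (map u xs) + sum (map v xs)) + (mu a + tau a)    ≡⟨ interchange (sum (map u xs)) _ _ _ ⟩
        (sum (map u xs) + mu a) + (sum (map v xs) + tau a)    ≤⟨ +-mono-≤ (u-chain a b xs aA bA xs∉A ch)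
                                                                          (v-chain a b xs aA bA xs∉A ch) ⟩
        mu b + tau b                                          ≡⟨ sym (lam≡ b) ⟩
        lam b                                                 ∎
        where open ≤-Reasoning

  restrict-chain-bound : ∀ {lam s P} (P? : U.Decidable P) → InS _≺_ A lam s →
                         ∀ a b xs → a ∈ A → b ∈ A → All (_∉ A) xs → Chain _≺_ A a xs b →
                         sum (map (s ↾ P?) xs) + (lam ↾ P?) a ≤ lam b
  restrict-chain-bound P? (_ , s-chain) a b xs aA bA xs∉A ch =
    ≤-trans (+-mono-≤ (sum-map-mono (λ _ → ↾-≤ P?) xs) (↾-≤ P?)) (s-chain a b xs aA bA xs∉A ch)

module Marked {n : ℕ} {_≺_ : Rel (Fin n) 0ℓ}
              (spo : IsStrictPartialOrder _≡_ _≺_) (_≺?_ : Decidable _≺_)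
              (A : Subset n)
              (maxA : ∀ x → (∀ y → ¬ (x ≺ y)) → x ∈ A)
              (minA : ∀ x → (∀ y → ¬ (y ≺ x)) → x ∈ A)
              {lam : Fin n → ℕ} (lamQ : InQ _≺_ A lam) where

  open IsStrictPartialOrder spo using () renaming (trans to ≺-trans; irrefl to ≺-irrefl)
  open Order spo _≺?_
  open Chains spo A
  open Minkowski _≺_ A

  R : Fin n → Set
  R = InReduced _≺_ A lam

  R-up : ∀ {x y} → R x → x ≺ y → R y
  R-up Rx x≺y (z , zA , z≡0 , inj₁ refl) = Rx (z , zA , z≡0 , inj₂ x≺y)
  R-up Rx x≺y (z , zA , z≡0 , inj₂ y≺z)  = Rx (z , zA , z≡0 , inj₂ (≺-trans x≺y y≺z))

  reduced⇒mark≢0 : ∀ {a} → a ∈ A → R a → ¬ (lam a ≡ 0)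
  reduced⇒mark≢0 {a} aA Ra a≡0 = Ra (a , aA , a≡0 , inj₁ refl)

  mark≢0⇒reduced : ∀ {a} → a ∈ A → ¬ (lam a ≡ 0) → R a
  mark≢0⇒reduced aA a≢0 (z , zA , z≡0 , inj₁ refl) = a≢0 z≡0
  mark≢0⇒reduced aA a≢0 (z , zA , z≡0 , inj₂ a≺z)  =
    a≢0 (n≤0⇒n≡0 (≤-trans (lamQ _ z aA zA a≺z) (≤-reflexive z≡0)))

  -- Every chain from outside A up to A extends downwards to a chain starting in A.
  chain-down-bound : ∀ {s} → InS _≺_ A lam s → ∀ {x b} xs → x ∉ A → All (_∉ A) xs →
                     Chain _≺_ A x xs b → b ∈ A →
                     ∃ λ a → a ∈ A × sum (map s (x ∷ xs)) + lam a ≤ lam b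
  chain-down-bound {s} (_ , s-chain) {x} {b} xs x∉A xs∉A ch bA =
    go x (spo-wellFounded spo x) xs x∉A xs∉A ch
    where
      go : ∀ x → Acc _≺_ x → ∀ xs → x ∉ A → All (_∉ A) xs → Chain _≺_ A x xs b →
           ∃ λ a → a ∈ A × sum (map s (x ∷ xs)) + lam a ≤ lam b
      go x (acc rec) xs x∉A xs∉A ch with any? (_≺? x)
      ... | no ∄y = ⊥-elim (x∉A (minA x λ y y≺x → ∄y (y , y≺x)))
      ... | yes (y , y≺x) with y ∈? A
      ...   | yes yA = y , yA , s-chain y b (x ∷ xs) yA bA (x∉A ∷ xs∉A) (y≺x , ch)
      ...   | no y∉A with go y (rec y≺x) (x ∷ xs) y∉A (x∉A ∷ xs∉A) (y≺x , ch)
      ...     | a , aA , bound = a , aA , ≤-trans (+-monoˡ-≤ (lam a) (m≤n+m _ (s y))) bound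

  InS-vanish : ∀ {s x} → InS _≺_ A lam s → x ∉ A → ¬ R x → s x ≡ 0
  InS-vanish {s} {x} s∈S x∉A ¬Rx = decidable-stable (s x ≟ 0) λ sx≢0 → ¬Rx λ where
    (z , zA , z≡0 , inj₁ refl) → x∉A zA
    (z , zA , z≡0 , inj₂ x≺z)  →
      let (a , _ , bound) = chain-down-bound s∈S [] x∉A [] x≺z zA
      in sx≢0 (n≤0⇒n≡0 (≤-trans (≤-trans (m≤m+n (s x) 0) (m≤m+n _ (lam a)))
                                (≤-trans bound (≤-reflexive z≡0))))

  InS-zero : ∀ {s} → (∀ x → s x ≡ 0) → InS _≺_ A lam s
  InS-zero s≡0 = (λ a _ → s≡0 a) , λ a b xs aA bA _ ch →
    subst (λ t → t + lam a ≤ lam b) (sym (sum-map-zero (universal s≡0 xs)))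
          (lamQ a b aA bA (chain-lt xs ch))

  Adjacent : Rel (Fin n) 0ℓ
  Adjacent x y = Σ (R x) λ Rx → Σ (R y) λ Ry → HasseEdge _≺_ A lam (x , Rx) (y , Ry)

  Connected : Rel (Fin n) 0ℓ
  Connected = Star Adjacent

  Adjacent-sym : ∀ {x y} → Adjacent x y → Adjacent y x
  Adjacent-sym (Rx , Ry , e) = Ry , Rx , ⊎-swap e

  Connected-sym : ∀ {x y} → Connected x y → Connected y x
  Connected-sym = reverse Adjacent-sym

  Connected-R : ∀ {x y} → R x → Connected x y → R y
  Connected-R Rx ε                  = Rx
  Connected-R _  ((_ , Ry , _) ◅ c) = Connected-R Ry c

  cover-adjacent : ∀ {x y} → R x → x ⋖ y → Adjacent x y
  cover-adjacent Rx (x≺y , ∄z) =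
    Rx , R-up Rx x≺y , inj₁ (x≺y , λ (z , _ , x≺z , z≺y) → ∄z (z , x≺z , z≺y))

  connected-≺ : ∀ {x y} → R x → x ≺ y → Connected x y
  connected-≺ {x} {y} = go x (spo-noetherian spo x)
    where
      go : ∀ x → Acc (flip _≺_) x → R x → x ≺ y → Connected x y
      go x (acc rec) Rx x≺y with ∃-cover-below x≺y
      ... | z , x⋖z , inj₁ refl = cover-adjacent Rx x⋖z ◅ ε
      ... | z , x⋖z , inj₂ z≺y  =
        cover-adjacent Rx x⋖z ◅ go z (rec (proj₁ x⋖z)) (R-up Rx (proj₁ x⋖z)) z≺y

  ∃-connected-A : ∀ {x} → R x → ∃ λ a → a ∈ A × Connected x a
  ∃-connected-A {x} Rx with ∃-maximal-above x
  ... | a , inj₁ refl , a-max = a , maxA a a-max , ε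
  ... | a , inj₂ x≺a  , a-max = a , maxA a a-max , connected-≺ Rx x≺a

  Connected-up : ∀ {x₀ x y} → R x₀ → Connected x₀ x → x ≺ y → Connected x₀ y
  Connected-up Rx₀ c x≺y = c ◅◅ connected-≺ (Connected-R Rx₀ c) x≺y

  Connected-down : ∀ {x₀ x y} → R x → x ≺ y → Connected x₀ y → Connected x₀ x
  Connected-down Rx x≺y c = c ◅◅ Connected-sym (connected-≺ Rx x≺y)

  module ComponentSplit {C : Fin n → Set} (C? : U.Decidable C)
                        (C-up : ∀ {x y} → C x → x ≺ y → C y)
                        (C-down : ∀ {x y} → R x → x ≺ y → C y → C x) where

    mu tau : Fin n → ℕ
    mu  = lam ↾ C?
    tau = lam ↾ ∁? C?

    mark-below-C : ∀ {a b} → a ∈ A → ¬ C a → a ≺ b → C b → lam a ≡ 0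
    mark-below-C aA ¬Ca a≺b Cb =
      decidable-stable (_ ≟ 0) λ a≢0 → ¬Ca (C-down (mark≢0⇒reduced aA a≢0) a≺b Cb)

    mu-InQ : InQ _≺_ A mu
    mu-InQ a b aA bA a≺b with C? a | C? b
    ... | yes _  | yes _   = lamQ a b aA bA a≺b
    ... | yes Ca | no ¬Cb  = ⊥-elim (¬Cb (C-up Ca a≺b))
    ... | no _   | _       = z≤n

    tau-InQ : InQ _≺_ A tau
    tau-InQ a b aA bA a≺b with C? a | C? b
    ... | yes _   | _      = z≤n
    ... | no ¬Ca  | yes Cb = ≤-reflexive (mark-below-C aA ¬Ca a≺b Cb)
    ... | no _    | no _   = lamQ a b aA bA a≺b

    module _ {s : Fin n → ℕ} (s∈S : InS _≺_ A lam s) where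

      mu-part : InS _≺_ A mu (s ↾ C?)
      mu-part = (λ a aA → ↾-zero C? (proj₁ s∈S a aA)) , chain
        where
          chain : ∀ a b xs → a ∈ A → b ∈ A → All (_∉ A) xs → Chain _≺_ A a xs b →
                  sum (map (s ↾ C?) xs) + mu a ≤ mu b
          chain a b xs aA bA xs∉A ch with C? b
          ... | yes _  = restrict-chain-bound C? s∈S a b xs aA bA xs∉A ch
          ... | no ¬Cb = ≤-reflexive (cong₂ _+_ (sum-map-zero (All.map outside (chain-below xs ch)))
                                              (outside (chain-lt xs ch)))
            where
              outside : ∀ {f y} → y ≺ b → (f ↾ C?) y ≡ 0
              outside y≺b = ↾-out C? (¬Cb ∘ flip C-up y≺b)

      tau-part : InS _≺_ A tau (s ↾ ∁? C?)
      tau-part = (λ a aA → ↾-zero (∁? C?) (proj₁ s∈S a aA)) , chain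
        where
          chain : ∀ a b xs → a ∈ A → b ∈ A → All (_∉ A) xs → Chain _≺_ A a xs b →
                  sum (map (s ↾ ∁? C?) xs) + tau a ≤ tau b
          chain a b xs aA bA xs∉A ch with C? b
          ... | no _   = restrict-chain-bound (∁? C?) s∈S a b xs aA bA xs∉A ch
          ... | yes Cb = ≤-reflexive (cong₂ _+_ (sum-map-zero (All.zipWith below-C (xs∉A , chain-below xs ch)))
                                              tau-a≡0)
            where
              -- Below C, everything outside C lies outside R, where s vanishes.
              below-C : ∀ {y} → y ∉ A × y ≺ b → (s ↾ ∁? C?) y ≡ 0
              below-C {y} (y∉A , y≺b) with C? y
              ... | yes _  = refl
              ... | no ¬Cy = InS-vanish s∈S y∉A (λ Ry → ¬Cy (C-down Ry y≺b Cb))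

              tau-a≡0 : tau a ≡ 0
              tau-a≡0 with C? a
              ... | yes _  = refl
              ... | no ¬Ca = mark-below-C aA ¬Ca (chain-lt xs ch) Cb

    split-SumEq : SumEq _≺_ A lam mu tau
    split-SumEq s = (λ s∈S → s ↾ C? , s ↾ ∁? C? , mu-part s∈S , tau-part s∈S , λ _ → ↾-split C?)
                  , λ (u , v , u∈S , v∈S , s≡) → InS-+ (λ _ → ↾-split C?) u∈S v∈S s≡

  disconnected-decomposable : ∀ {x y} → R x → R y → ¬ Connected x y → U.Decidable (Connected x) →
                              ¬ CIndecomposable _≺_ A lam
  disconnected-decomposable {x} {y} Rx Ry x≁y C? (_ , indec) =
    [ mu≢0 , tau≢0 ] (indec mu tau mu-InQ tau-InQ split-SumEq)
    where
      open ComponentSplit C? (Connected-up Rx) Connected-down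

      mu≢0 : ¬ IsZero _≺_ A mu
      mu≢0 mu≡0 with ∃-connected-A Rx
      ... | a , aA , x~a =
        reduced⇒mark≢0 aA (Connected-R Rx x~a) (trans (sym (↾-in C? x~a)) (mu≡0 a aA))

      tau≢0 : ¬ IsZero _≺_ A tau
      tau≢0 tau≡0 with ∃-connected-A Ry
      ... | b , bA , y~b =
        reduced⇒mark≢0 bA (Connected-R Ry y~b)
          (trans (sym (↾-in (∁? C?) λ x~b → x≁y (x~b ◅◅ Connected-sym y~b))) (tau≡0 b bA))

  reduced⊆A-SumEq : (∀ x → R x → x ∈ A) → SumEq _≺_ A lam lam lam
  reduced⊆A-SumEq R⊆A s = (λ s∈S → s , s , s∈S , s∈S , λ x → doubled (InS≡0 s∈S x))
                        , λ (u , v , u∈S , v∈S , s≡) →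
                            InS-zero λ x → trans (s≡ x) (cong₂ _+_ (InS≡0 u∈S x) (InS≡0 v∈S x))
    where
      InS≡0 : ∀ {s} → InS _≺_ A lam s → ∀ x → s x ≡ 0
      InS≡0 s∈S x with x ∈? A
      ... | yes xA = proj₁ s∈S x xA
      ... | no x∉A = InS-vanish s∈S x∉A (x∉A ∘ R⊆A x)

      doubled : ∀ {m} → m ≡ 0 → m ≡ m + m
      doubled refl = refl

  reduced⊆A-decomposable : ∀ {x} → R x → (∀ y → R y → y ∈ A) → ¬ CIndecomposable _≺_ A lam
  reduced⊆A-decomposable {x} Rx R⊆A (_ , indec) =
    [ lam≢0 , lam≢0 ] (indec lam lam lamQ lamQ (reduced⊆A-SumEq R⊆A))
    where
      lam≢0 : ¬ IsZero _≺_ A lam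
      lam≢0 lam≡0 = reduced⇒mark≢0 (R⊆A x Rx) Rx (lam≡0 x (R⊆A x Rx))

  isolated-reduced⊆A : ∀ {x} → R x → ¬ ∃ (Adjacent x) → (∀ y → R y → Connected x y) →
                       ∀ y → R y → y ∈ A
  isolated-reduced⊆A {x} Rx isolated conn y Ry = subst (_∈ A) (unique Ry) x∈A
    where
      unique : ∀ {y} → R y → x ≡ y
      unique Ry with conn _ Ry
      ... | ε     = refl
      ... | e ◅ _ = ⊥-elim (isolated (_ , e))

      x∈A : x ∈ A
      x∈A = maxA x λ z x≺z → ≺-irrefl (unique (R-up Rx x≺z)) x≺z

  -- Reducedness is a negation, so the vertices (x , p) and (x , q) of the
  -- Hasse diagram need not be equal: even the trivial path uses an edge.
  hasse-path : ∀ {x w y} (Rx : R x) (Ry : R y) → Adjacent x w → Connected w y →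
               Star (HasseEdge _≺_ A lam) (x , Rx) (y , Ry)
  hasse-path Rx Ry (_ , Rw , e) ε        = e ◅ ε
  hasse-path Rx Ry (_ , Rw , e) (e′ ◅ c) = e ◅ hasse-path Rw Ry e′ c

  hasse-connected : (∀ x y → R x → R y → Connected x y) → (∀ x → R x → ∃ (Adjacent x)) →
                    HasseConnected _≺_ A lam
  hasse-connected conn neighbour (x , Rx) (y , Ry) with conn x y Rx Ry
  ... | ε     = let (_ , e) = neighbour x Rx in hasse-path Rx Ry e (Adjacent-sym e ◅ ε)
  ... | e ◅ c = hasse-path Rx Ry e c

  not-indecomposable : Decidable Connected → U.Decidable (∃ ∘ Adjacent) →
                       ¬ HasseConnected _≺_ A lam → ¬ CIndecomposable _≺_ A lam
  not-indecomposable connected? adjacent? ¬hc indec =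
    ¬¬-excluded-middle {A = ∃₂ λ x y → R x × R y × ¬ Connected x y} λ where
      (yes (x , y , Rx , Ry , x≁y)) → disconnected-decomposable Rx Ry x≁y (connected? x) indec
      (no ∄x≁y) →
        let conn x y Rx Ry = decidable-stable (connected? x y) λ x≁y → ∄x≁y (x , y , Rx , Ry , x≁y)
        in ¬¬-excluded-middle {A = ∃ λ x → R x × ¬ ∃ (Adjacent x)} λ where
          (yes (x , Rx , isolated)) →
            reduced⊆A-decomposable Rx (isolated-reduced⊆A Rx isolated λ y → conn x y Rx) indec
          (no ∄isolated) → ¬hc (hasse-connected conn λ x Rx →
            decidable-stable (adjacent? x) λ isolated → ∄isolated (x , Rx , isolated))

mainTheorem6 : {n : ℕ} (_≺_ : Rel (Fin n) 0ℓ) → IsStrictPartialOrder _≡_ _≺_ →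
    (A : Subset n) →
    (∀ x → (∀ y → ¬ (x ≺ y)) → x ∈ A) →
    (∀ x → (∀ y → ¬ (y ≺ x)) → x ∈ A) →
    (lam : Fin n → ℕ) → InQ0 _≺_ A lam →
    (∀ a → a ∈ A → lam a ≡ 0 ⊎ lam a ≡ 1) →
    ¬ HasseConnected _≺_ A lam →
    ¬ CIndecomposable _≺_ A lam
-- The conclusion is a negation, so every case distinction may be decided
-- classically.
mainTheorem6 _≺_ spo A maxA minA lam (lamQ , _) _ ¬hc indec =
  ¬¬-decidable₂ _≺_ λ _≺?_ →
  let open Marked spo _≺?_ A maxA minA lamQ in
  ¬¬-decidable₂ Connected λ connected? →
  ¬¬-decidable (∃ ∘ Adjacent) λ adjacent? →
  not-indecomposable connected? adjacent? ¬hc indec
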